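{- Let $Q$ be an HDA. If there exist a state $q\in Q_0$ and rooted paths $\pi,\pi'$ both ending at $q$ with $S_\pi=T_\pi=S$, $S_{\pi'}=T_{\pi'}=S'$ and $|S|\ne|S'|$, then $Q$ cannot be sculpted.
   Context: Precubical sets: families of disjoint sets $Q_n$ with face maps $s_k,t_k:Q_n\to Q_{n-1}$ ($k=1,\dots,n$) satisfying $\alpha_k\beta_\ell=\beta_{\ell-1}\alpha_k$ for $\alpha,\beta\in\{s,t\}$, $k<\ell$. An HDA is a finite precubical set with initial cell $I\in Q_0$; HDA morphisms commute with face maps and preserve initial cells; embeddings are injective ones. The bulk $B^d$ has $n$-cells the tuples in $\{0,\ast,1\}^d$ with exactly $n$ entries $\ast$; $s_k$ (resp. $t_k$) replaces the $k$-th $\ast$ by $0$ (resp. $1$); initial cell $(0,\dots,0)$. $Q$ can be sculpted if there is an HDA embedding $Q\hookrightarrow B^d$ for some $d$. Steps: $q'\xrightarrow{s_i}q$ with $s_iq=q'$, $q\xrightarrow{t_i}q'$ with $t_iq=q'$; rooted paths start at $I$. Universal labels: $\approx$ is the equivalence on $Q_1$ generated by $(s_iq,t_iq)$, $q\in Q_2$, $i\in\{1,2\}$; $\lambda(e)$ the class of $e$; $\lambda_i(q)=\lambda(s_1\cdots s_{i-1}s_{i+1}\cdots s_n(q))$. For rooted $\pi$: trivial path gives $(\emptyset,\emptyset)$; $\pi=\pi'\xrightarrow{s_i}q$ gives $S_\pi=S_{\pi'}\cup\{\lambda_i(q)\}$, $T_\pi=T_{\pi'}$; $\pi=\pi'\xrightarrow{t_i}t_i(q')$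 with $q'$ the end of $\pi'$ gives $S_\pi=S_{\pi'}$, $T_\pi=T_{\pi'}\cup\{\lambda_i(q')\}$. -}

module Defs where

open import Data.Nat using (ℕ; zero; suc; _<_; _≤_; s≤s; z≤n)
open import Data.Fin using (Fin; zero; suc; toℕ; inject₁; fromℕ)
open import Data.Bool using (Bool; true; false)
open import Data.Vec using (Vec; []; _∷_)
open import Data.Product using (Σ; ∃; _×_; _,_; proj₁; proj₂)
open import Data.Sum using (_⊎_)
open import Data.Empty using (⊥)
open import Relation.Nullary using (¬_)
open import Relation.Binary.PropositionalEquality using (_≡_; refl; cong; subst; sym)
open import Function.Bundles using (_↔_; _⇔_)

-- Convention: Bool false = source face s, true = target face t.
-- Indices are 0-based: face α n k (k : Fin (suc n)) is α_{k+1} : Q_{n+1} → Q_n.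

record PreData : Set₁ where
  field
    Cell : ℕ → Set
    face : Bool → (n : ℕ) → Fin (suc n) → Cell (suc n) → Cell n
    init : Cell 0

record HDA : Set₁ where
  field
    pre : PreData
  open PreData pre public
  field
    -- precubical identities  α_k β_ℓ = β_{ℓ-1} α_k  for k < ℓ
    -- (0-based: k ≤ ℓ' where ℓ = ℓ' + 1)
    cubical : ∀ (α β : Bool) (n : ℕ) (k ℓ' : Fin (suc n)) (x : Cell (suc (suc n))) →
      toℕ k ≤ toℕ ℓ' →
      face α n k (face β (suc n) (suc ℓ') x) ≡ face β n ℓ' (face α (suc n) (inject₁ k) x)
    finiteCells : ∀ n → ∃ λ k → Cell n ↔ Fin k
    boundedDim : ∃ λ D → ∀ n → D < n → ¬ Cell n

data Tri : Set where
  z st o : Tri        -- 0, ∗, 1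

bit : Bool → Tri
bit false = z
bit true  = o

stars : ∀ {d} → Vec Tri d → ℕ
stars [] = 0
stars (z ∷ v) = stars v
stars (st ∷ v) = suc (stars v)
stars (o ∷ v) = stars v

rep : ∀ {d} → Bool → ℕ → Vec Tri d → Vec Tri d
rep b k [] = []
rep b k (z ∷ v) = z ∷ rep b k v
rep b k (o ∷ v) = o ∷ rep b k v
rep b zero (st ∷ v) = bit b ∷ v
rep b (suc k) (st ∷ v) = st ∷ rep b k v

stars-bit : ∀ {d} b (v : Vec Tri d) → stars (bit b ∷ v) ≡ stars v
stars-bit false v = refl
stars-bit true v = refl

stars-rep : ∀ {d} b k (v : Vec Tri d) → k < stars v → suc (stars (rep b k v)) ≡ stars v
stars-rep b k (z ∷ v) p = stars-rep b k v p
stars-rep b k (o ∷ v) p = stars-rep b k v p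
stars-rep b zero (st ∷ v) p = cong suc (stars-bit b v)
stars-rep b (suc k) (st ∷ v) (s≤s p) = cong suc (stars-rep b k v p)

BCell : ℕ → ℕ → Set
BCell d n = Σ (Vec Tri d) (λ v → stars v ≡ n)

bface : (d : ℕ) → Bool → (n : ℕ) → Fin (suc n) → BCell d (suc n) → BCell d n
bface d b n k (v , p) = rep b (toℕ k) v , suc-inj (trans' (stars-rep b (toℕ k) v (lt k p)) p)
  where
  suc-inj : ∀ {a c : ℕ} → suc a ≡ suc c → a ≡ c
  suc-inj refl = refl
  trans' : ∀ {a b c : ℕ} → a ≡ b → b ≡ c → a ≡ c
  trans' refl q = q
  toℕ<n : ∀ {m} (i : Fin m) → toℕ i < m
  toℕ<n zero = s≤s z≤n
  toℕ<n (suc i) = s≤s (toℕ<n i)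
  lt : (k : Fin (suc n)) → stars v ≡ suc n → toℕ k < stars v
  lt k e = subst (toℕ k <_) (sym e) (toℕ<n k)

allZ : (d : ℕ) → Vec Tri d
allZ zero = []
allZ (suc d) = z ∷ allZ d

stars-allZ : ∀ d → stars (allZ d) ≡ 0
stars-allZ zero = refl
stars-allZ (suc d) = stars-allZ d

Bulk : ℕ → PreData
Bulk d = record
  { Cell = BCell d
  ; face = bface d
  ; init = allZ d , stars-allZ d
  }

record Embedding (P R : PreData) : Set where
  module P = PreData P
  module R = PreData R
  field
    map : ∀ n → P.Cell n → R.Cell n
    map-face : ∀ α n k (x : P.Cell (suc n)) →
      map n (P.face α n k x) ≡ R.face α n k (map (suc n) x)
    map-init : map 0 P.init ≡ R.init
    injective : ∀ n (x y : P.Cell n) → map n x ≡ map n y → x ≡ y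

CanBeSculpted : HDA → Set
CanBeSculpted Q = ∃ λ d → Embedding (HDA.pre Q) (Bulk d)

module _ (Q : HDA) where
  open HDA Q

  data _≈_ : Cell 1 → Cell 1 → Set where
    ≈-gen   : ∀ (i : Fin 2) (q : Cell 2) → face false 1 i q ≈ face true 1 i q
    ≈-refl  : ∀ {e} → e ≈ e
    ≈-sym   : ∀ {e e'} → e ≈ e' → e' ≈ e
    ≈-trans : ∀ {e e' e''} → e ≈ e' → e' ≈ e'' → e ≈ e''

  data LastView : {n : ℕ} → Fin (suc n) → Set where
    isLast : ∀ {n} → LastView (fromℕ n)
    isInj  : ∀ {n} (j : Fin n) → LastView (inject₁ j)

  lastView : ∀ {n} (i : Fin (suc n)) → LastView i
  lastView {zero} zero = isLast
  lastView {suc n} zero = isInj zero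
  lastView {suc n} (suc i) with lastView i
  ... | isLast = isLast
  ... | isInj j = isInj (suc j)

  -- edgeAt n i q = s_1 ⋯ s_{i-1} s_{i+1} ⋯ s_{n+1} (q)   for q ∈ Q_{n+1}
  -- (0-based i; rightmost face applied first)
  edgeAt : (n : ℕ) (i : Fin (suc n)) → Cell (suc n) → Cell 1
  edgeAt-v : (m : ℕ) (i : Fin (suc (suc m))) → LastView i → Cell (suc (suc m)) → Cell 1
  edgeAt zero i q = q
  edgeAt (suc m) i q = edgeAt-v m i (lastView i) q
  edgeAt-v m .(fromℕ (suc m)) isLast q = edgeAt m (fromℕ m) (face false (suc m) (inject₁ (fromℕ m)) q)
  edgeAt-v m .(inject₁ j) (isInj j) q = edgeAt m j (face false (suc m) (fromℕ (suc m)) q)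

  -- λ_i(q) is the ≈-class of edgeAt n i q

  data Path : (n : ℕ) → Cell n → Set where
    triv : Path 0 init
    up   : ∀ {n} (i : Fin (suc n)) (q : Cell (suc n)) → Path n (face false n i q) → Path (suc n) q
    down : ∀ {n} (i : Fin (suc n)) {q : Cell (suc n)} → Path (suc n) q → Path n (face true n i q)

  -- sets of labels, represented as (≈-closed) predicates on Q_1:
  -- e ∈ S_π  iff  λ(e) ∈ S_π
  Sset : ∀ {n q} → Path n q → Cell 1 → Set
  Sset triv e = ⊥
  Sset (up {n} i q p) e = Sset p e ⊎ (e ≈ edgeAt n i q)
  Sset (down i p) e = Sset p e

  Tset : ∀ {n q} → Path n q → Cell 1 → Set
  Tset triv e = ⊥
  Tset (up i q p) e = Tset p e
  Tset (down {n} i {q} p) e = Tset p e ⊎ (e ≈ edgeAt n i q)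

  SameLabels : (Cell 1 → Set) → (Cell 1 → Set) → Set
  SameLabels A B = ∀ e → A e ⇔ B e

  HasCard : (Cell 1 → Set) → ℕ → Set
  HasCard A k = Σ (Fin k → Cell 1) λ f →
    (∀ i → A (f i)) ×
    (∀ i j → f i ≈ f j → i ≡ j) ×
    (∀ e → A e → ∃ λ i → e ≈ f i)

module Submission where

-- Suppose Q embeds into the bulk B^d.  Every edge e is then a
-- vector with exactly one ∗, and its position `coord e` is the coordinate
-- of B^d that e moves along.  This coordinate is invariant under ≈, since
-- opposite faces of a square move along the same coordinate; and the label
-- λ_i(q) of a cell q is the coordinate of the i-th ∗ of q.
--
-- Along a rooted path the coordinates of the endpoint start all equal to 0;
-- an s-step turns one 0 into ∗ (the coordinate of the new label), a t-step
-- turns a ∗ into 1, and no step ever turns a non-zero coordinate back to 0.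
-- Hence, for every rooted path π to a cell x, `coord` is a bijection from
-- the labels of S_π onto the non-zero coordinates of x (`SupportLabelling`).
-- So |S_π| depends only on the end point of π: two rooted paths to the same
-- state have label sets of equal size, and the hypothesis |S| ≠ |S'| rules
-- out an embedding.

open import Defs
open import Data.Nat using (ℕ)
open import Data.Product using (∃; ∃₂; _×_)
open import Relation.Nullary using (¬_)
open import Relation.Binary.PropositionalEquality using (_≢_)

open import Data.Nat using (zero; suc; _<_; _≤_; s≤s)
open import Data.Nat.Properties using (≤-antisym; ≤-refl)
open import Data.Fin using (Fin; toℕ; fromℕ; inject₁)
open import Data.Fin.Properties using (toℕ<n; toℕ-fromℕ; toℕ-inject₁; injective⇒≤)
open import Data.Bool using (Bool; true; false)
open import Data.Vec using (Vec; []; _∷_)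
open import Data.Product using (Σ; _,_; proj₁; proj₂)
open import Data.Sum using (inj₁; inj₂)
open import Data.Empty using (⊥; ⊥-elim)
open import Relation.Nullary using (Dec; yes; no)
open import Relation.Binary.PropositionalEquality
  using (_≡_; refl; cong; sym; trans; subst; module ≡-Reasoning)

-- The coordinate of the k-th ∗ of v (0-based; meaningful when k < stars v).
starPos : ∀ {d} → ℕ → Vec Tri d → ℕ
starPos k [] = 0
starPos k (z ∷ v) = suc (starPos k v)
starPos k (o ∷ v) = suc (starPos k v)
starPos zero (st ∷ v) = 0
starPos (suc k) (st ∷ v) = suc (starPos k v)

-- The j-th entry of v (out-of-range coordinates read as 0).
entry : ∀ {d} → Vec Tri d → ℕ → Tri
entry [] j = z
entry (x ∷ v) zero = x
entry (x ∷ v) (suc j) = entry v j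

isZero? : (t : Tri) → Dec (t ≡ z)
isZero? z = yes refl
isZero? st = no (λ ())
isZero? o = no (λ ())

starPos-bit : ∀ {d} b k (v : Vec Tri d) → starPos k (bit b ∷ v) ≡ suc (starPos k v)
starPos-bit false k v = refl
starPos-bit true k v = refl

starPos-rep-bit : ∀ {d} b b' k k' (v : Vec Tri d) →
  starPos k' (rep b k v) ≡ starPos k' (rep b' k v)
starPos-rep-bit b b' k k' [] = refl
starPos-rep-bit b b' k k' (z ∷ v) = cong suc (starPos-rep-bit b b' k k' v)
starPos-rep-bit b b' k k' (o ∷ v) = cong suc (starPos-rep-bit b b' k k' v)
starPos-rep-bit b b' zero k' (st ∷ v) = trans (starPos-bit b k' v) (sym (starPos-bit b' k' v))
starPos-rep-bit b b' (suc k) zero (st ∷ v) = refl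
starPos-rep-bit b b' (suc k) (suc k') (st ∷ v) = cong suc (starPos-rep-bit b b' k k' v)

starPos-rep-below : ∀ {d} b k k' (v : Vec Tri d) → k' < k →
  starPos k' (rep b k v) ≡ starPos k' v
starPos-rep-below b k k' [] lt = refl
starPos-rep-below b k k' (z ∷ v) lt = cong suc (starPos-rep-below b k k' v lt)
starPos-rep-below b k k' (o ∷ v) lt = cong suc (starPos-rep-below b k k' v lt)
starPos-rep-below b (suc k) zero (st ∷ v) lt = refl
starPos-rep-below b (suc k) (suc k') (st ∷ v) (s≤s lt) = cong suc (starPos-rep-below b k k' v lt)

starPos-rep-above : ∀ {d} b k k' (v : Vec Tri d) → k ≤ k' →
  starPos k' (rep b k v) ≡ starPos (suc k') v
starPos-rep-above b k k' [] le = refl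
starPos-rep-above b k k' (z ∷ v) le = cong suc (starPos-rep-above b k k' v le)
starPos-rep-above b k k' (o ∷ v) le = cong suc (starPos-rep-above b k k' v le)
starPos-rep-above b zero k' (st ∷ v) le = starPos-bit b k' v
starPos-rep-above b (suc k) (suc k') (st ∷ v) (s≤s le) = cong suc (starPos-rep-above b k k' v le)

entry-starPos : ∀ {d} k (v : Vec Tri d) → k < stars v → entry v (starPos k v) ≡ st
entry-starPos k (z ∷ v) lt = entry-starPos k v lt
entry-starPos k (o ∷ v) lt = entry-starPos k v lt
entry-starPos zero (st ∷ v) lt = refl
entry-starPos (suc k) (st ∷ v) (s≤s lt) = entry-starPos k v lt

entry-rep-zero : ∀ {d} b k j (v : Vec Tri d) → entry v j ≡ z → entry (rep b k v) j ≡ z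
entry-rep-zero b k j [] e = e
entry-rep-zero b k zero (z ∷ v) e = e
entry-rep-zero b k (suc j) (z ∷ v) e = entry-rep-zero b k j v e
entry-rep-zero b k (suc j) (o ∷ v) e = entry-rep-zero b k j v e
entry-rep-zero b zero (suc j) (st ∷ v) e = e
entry-rep-zero b (suc k) (suc j) (st ∷ v) e = entry-rep-zero b k j v e

entry-rep-true-zero : ∀ {d} k j (v : Vec Tri d) → entry (rep true k v) j ≡ z → entry v j ≡ z
entry-rep-true-zero k j [] e = e
entry-rep-true-zero k zero (z ∷ v) e = e
entry-rep-true-zero k zero (o ∷ v) e = e
entry-rep-true-zero zero zero (st ∷ v) ()
entry-rep-true-zero (suc k) zero (st ∷ v) ()
entry-rep-true-zero k (suc j) (z ∷ v) e = entry-rep-true-zero k j v e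
entry-rep-true-zero k (suc j) (o ∷ v) e = entry-rep-true-zero k j v e
entry-rep-true-zero zero (suc j) (st ∷ v) e = e
entry-rep-true-zero (suc k) (suc j) (st ∷ v) e = entry-rep-true-zero k j v e

entry-rep-false-starPos : ∀ {d} k (v : Vec Tri d) → k < stars v →
  entry (rep false k v) (starPos k v) ≡ z
entry-rep-false-starPos k (z ∷ v) lt = entry-rep-false-starPos k v lt
entry-rep-false-starPos k (o ∷ v) lt = entry-rep-false-starPos k v lt
entry-rep-false-starPos zero (st ∷ v) lt = refl
entry-rep-false-starPos (suc k) (st ∷ v) (s≤s lt) = entry-rep-false-starPos k v lt

entry-rep-false-new-zero : ∀ {d} k j (v : Vec Tri d) →
  entry v j ≢ z → entry (rep false k v) j ≡ z → j ≡ starPos k v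
entry-rep-false-new-zero k j [] nz e = ⊥-elim (nz e)
entry-rep-false-new-zero k zero (z ∷ v) nz e = ⊥-elim (nz refl)
entry-rep-false-new-zero k zero (o ∷ v) nz ()
entry-rep-false-new-zero zero zero (st ∷ v) nz e = refl
entry-rep-false-new-zero (suc k) zero (st ∷ v) nz ()
entry-rep-false-new-zero k (suc j) (z ∷ v) nz e = cong suc (entry-rep-false-new-zero k j v nz e)
entry-rep-false-new-zero k (suc j) (o ∷ v) nz e = cong suc (entry-rep-false-new-zero k j v nz e)
entry-rep-false-new-zero zero (suc j) (st ∷ v) nz e = ⊥-elim (nz e)
entry-rep-false-new-zero (suc k) (suc j) (st ∷ v) nz e = cong suc (entry-rep-false-new-zero k j v nz e)

entry-allZ : ∀ d j → entry (allZ d) j ≡ z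
entry-allZ zero j = refl
entry-allZ (suc d) zero = refl
entry-allZ (suc d) (suc j) = entry-allZ d j

module _ (Q : HDA) where
  open HDA Q

  HasCard-≤ : ∀ {A B : Cell 1 → Set} {k k'} (coord : Cell 1 → ℕ) →
    (∀ {e e'} → _≈_ Q e e' → coord e ≡ coord e') →
    (∀ e e' → A e → A e' → coord e ≡ coord e' → _≈_ Q e e') →
    (∀ e → A e → ∃ λ e' → B e' × coord e' ≡ coord e) →
    HasCard Q A k → HasCard Q B k' → k ≤ k'
  HasCard-≤ {A} {B} {k} {k'} coord coord-≈ coord-inj reach
            (f , f∈A , f-inj , _) (g , _ , _ , g-onto) = injective⇒≤ {f = h} h-inj
    where
    match : ∀ i → Σ (Fin k') λ i' → coord (g i') ≡ coord (f i)
    match i with reach (f i) (f∈A i)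
    ... | e' , e'∈B , same with g-onto e' e'∈B
    ... | i' , e'≈gi' = i' , trans (sym (coord-≈ e'≈gi')) same

    h : Fin k → Fin k'
    h i = proj₁ (match i)

    h-inj : ∀ {i₁ i₂} → h i₁ ≡ h i₂ → i₁ ≡ i₂
    h-inj {i₁} {i₂} eq = f-inj i₁ i₂ (coord-inj (f i₁) (f i₂) (f∈A i₁) (f∈A i₂)
      (trans (sym (proj₂ (match i₁))) (trans (cong (λ i' → coord (g i')) eq) (proj₂ (match i₂)))))

module Embedded (Q : HDA) (d : ℕ) (E : Embedding (HDA.pre Q) (Bulk d)) where
  open HDA Q
  module E = Embedding E

  vec : ∀ n → Cell n → Vec Tri d
  vec n x = proj₁ (E.map n x)

  vec-face : ∀ α n k x → vec n (face α n k x) ≡ rep α (toℕ k) (vec (suc n) x)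
  vec-face α n k x = cong proj₁ (E.map-face α n k x)

  index<stars : ∀ n (i : Fin (suc n)) x → toℕ i < stars (vec (suc n) x)
  index<stars n i x = subst (toℕ i <_) (sym (proj₂ (E.map (suc n) x))) (toℕ<n i)

  coord : Cell 1 → ℕ
  coord e = starPos 0 (vec 1 e)

  coord-≈ : ∀ {e e'} → _≈_ Q e e' → coord e ≡ coord e'
  coord-≈ (≈-gen i q) = begin
    starPos 0 (vec 1 (face false 1 i q))    ≡⟨ cong (starPos 0) (vec-face false 1 i q) ⟩
    starPos 0 (rep false (toℕ i) (vec 2 q)) ≡⟨ starPos-rep-bit false true (toℕ i) 0 (vec 2 q) ⟩
    starPos 0 (rep true (toℕ i) (vec 2 q))  ≡⟨ cong (starPos 0) (sym (vec-face true 1 i q)) ⟩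
    starPos 0 (vec 1 (face true 1 i q))     ∎
    where open ≡-Reasoning
  coord-≈ ≈-refl = refl
  coord-≈ (≈-sym r) = sym (coord-≈ r)
  coord-≈ (≈-trans r r') = trans (coord-≈ r) (coord-≈ r')

  coord-edgeAt : ∀ n (i : Fin (suc n)) q → coord (edgeAt Q n i q) ≡ starPos (toℕ i) (vec (suc n) q)
  coord-edgeAt zero Fin.zero q = refl
  coord-edgeAt (suc m) i q with lastView Q i
  ... | isLast = begin
    coord (edgeAt Q m (fromℕ m) (face false (suc m) (inject₁ (fromℕ m)) q))
      ≡⟨ coord-edgeAt m (fromℕ m) _ ⟩
    starPos (toℕ (fromℕ m)) (vec (suc m) (face false (suc m) (inject₁ (fromℕ m)) q))
      ≡⟨ cong (starPos (toℕ (fromℕ m))) (vec-face false (suc m) (inject₁ (fromℕ m)) q) ⟩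
    starPos (toℕ (fromℕ m)) (rep false (toℕ (inject₁ (fromℕ m))) v)
      ≡⟨ starPos-rep-above false _ _ v (subst (_≤ toℕ (fromℕ m)) (sym (toℕ-inject₁ (fromℕ m))) ≤-refl) ⟩
    starPos (suc (toℕ (fromℕ m))) v ∎
    where
    open ≡-Reasoning
    v = vec (suc (suc m)) q
  ... | isInj j = begin
    coord (edgeAt Q m j (face false (suc m) (fromℕ (suc m)) q))
      ≡⟨ coord-edgeAt m j _ ⟩
    starPos (toℕ j) (vec (suc m) (face false (suc m) (fromℕ (suc m)) q))
      ≡⟨ cong (starPos (toℕ j)) (vec-face false (suc m) (fromℕ (suc m)) q) ⟩
    starPos (toℕ j) (rep false (toℕ (fromℕ (suc m))) v)
      ≡⟨ starPos-rep-below false _ _ v (subst (toℕ j <_) (sym (toℕ-fromℕ (suc m))) (toℕ<n j)) ⟩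
    starPos (toℕ j) v
      ≡⟨ cong (λ t → starPos t v) (sym (toℕ-inject₁ j)) ⟩
    starPos (toℕ (inject₁ j)) v ∎
    where
    open ≡-Reasoning
    v = vec (suc (suc m)) q

  record SupportLabelling {n x} (p : Path Q n x) : Set where
    field
      label-in-support : ∀ e → Sset Q p e → entry (vec n x) (coord e) ≢ z
      support-labelled : ∀ j → entry (vec n x) j ≢ z → ∃ λ e → Sset Q p e × coord e ≡ j
      coord-injective  : ∀ e e' → Sset Q p e → Sset Q p e' → coord e ≡ coord e' → _≈_ Q e e'

  supportLabelling : ∀ {n x} (p : Path Q n x) → SupportLabelling p
  supportLabelling triv = record
    { label-in-support = λ e ()
    ; support-labelled = λ j nz → ⊥-elim (nz (subst (λ w → entry w j ≡ z)
                                                     (sym (cong proj₁ E.map-init)) (entry-allZ d j)))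
    ; coord-injective  = λ e e' ()
    }
  supportLabelling (up {n} i q p) = record
    { label-in-support = in-support
    ; support-labelled = labelled
    ; coord-injective  = injective
    }
    where
    module IH = SupportLabelling (supportLabelling p)
    v = vec (suc n) q
    k = toℕ i
    new = edgeAt Q n i q

    entry-source : ∀ j → entry (vec n (face false n i q)) j ≡ entry (rep false k v) j
    entry-source j = cong (λ w → entry w j) (vec-face false n i q)

    coord-new : ∀ {e} → _≈_ Q e new → coord e ≡ starPos k v
    coord-new r = trans (coord-≈ r) (coord-edgeAt n i q)

    -- that coordinate was 0 in the source, so it carries no old label
    old-not-new : ∀ e e' → Sset Q p e → _≈_ Q e' new → coord e ≡ coord e' → ⊥
    old-not-new e e' s r eq = IH.label-in-support e s (trans (entry-source (coord e))
      (subst (λ t → entry (rep false k v) t ≡ z) (sym (trans eq (coord-new r)))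
             (entry-rep-false-starPos k v (index<stars n i q))))

    in-support : ∀ e → Sset Q (up i q p) e → entry v (coord e) ≢ z
    in-support e (inj₁ s) ez =
      IH.label-in-support e s (trans (entry-source (coord e)) (entry-rep-zero false k (coord e) v ez))
    in-support e (inj₂ r) ez
      with trans (sym (trans (cong (entry v) (coord-new r)) (entry-starPos k v (index<stars n i q)))) ez
    ... | ()

    labelled : ∀ j → entry v j ≢ z → ∃ λ e → Sset Q (up i q p) e × coord e ≡ j
    labelled j nz with isZero? (entry (rep false k v) j)
    ... | yes ez = new , inj₂ ≈-refl , trans (coord-new ≈-refl) (sym (entry-rep-false-new-zero k j v nz ez))
    ... | no nz' with IH.support-labelled j (λ e → nz' (trans (sym (entry-source j)) e))
    ... | e , s , eq = e , inj₁ s , eq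

    injective : ∀ e e' → Sset Q (up i q p) e → Sset Q (up i q p) e' → coord e ≡ coord e' → _≈_ Q e e'
    injective e e' (inj₁ s) (inj₁ s') eq = IH.coord-injective e e' s s' eq
    injective e e' (inj₁ s) (inj₂ r') eq = ⊥-elim (old-not-new e e' s r' eq)
    injective e e' (inj₂ r) (inj₁ s') eq = ⊥-elim (old-not-new e' e s' r (sym eq))
    injective e e' (inj₂ r) (inj₂ r') eq = ≈-trans r (≈-sym r')
  supportLabelling (down {n} i {q} p) = record
    { label-in-support = in-support
    ; support-labelled = labelled
    ; coord-injective  = IH.coord-injective
    }
    where
    module IH = SupportLabelling (supportLabelling p)
    v = vec (suc n) q
    k = toℕ i

    entry-target : ∀ j → entry (vec n (face true n i q)) j ≡ entry (rep true k v) j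
    entry-target j = cong (λ w → entry w j) (vec-face true n i q)

    in-support : ∀ e → Sset Q (down i p) e → entry (vec n (face true n i q)) (coord e) ≢ z
    in-support e s ez =
      IH.label-in-support e s (entry-rep-true-zero k (coord e) v (trans (sym (entry-target (coord e))) ez))

    labelled : ∀ j → entry (vec n (face true n i q)) j ≢ z → ∃ λ e → Sset Q (down i p) e × coord e ≡ j
    labelled j nz = IH.support-labelled j (λ ez → nz (trans (entry-target j) (entry-rep-zero true k j v ez)))

  label-count-≤ : ∀ {n x} (π π' : Path Q n x) {k k'} →
    HasCard Q (Sset Q π) k → HasCard Q (Sset Q π') k' → k ≤ k'
  label-count-≤ π π' = HasCard-≤ Q coord coord-≈ L.coord-injective reach
    where
    module L  = SupportLabelling (supportLabelling π)
    module L' = SupportLabelling (supportLabelling π')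
    reach : ∀ e → Sset Q π e → ∃ λ e' → Sset Q π' e' × coord e' ≡ coord e
    reach e s = L'.support-labelled (coord e) (L.label-in-support e s)

lemma4p25 : (Q : HDA) (q : HDA.Cell Q 0) (π π' : Path Q 0 q) →
    SameLabels Q (Sset Q π) (Tset Q π) →
    SameLabels Q (Sset Q π') (Tset Q π') →
    (∃₂ λ (k k' : ℕ) → HasCard Q (Sset Q π) k × HasCard Q (Sset Q π') k' × k ≢ k') →
    ¬ CanBeSculpted Q
lemma4p25 Q q π π' _ _ (k , k' , card , card' , k≢k') (d , E) =
  k≢k' (≤-antisym (label-count-≤ π π' card card') (label-count-≤ π' π card' card))
  where open Embedded Q d E
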